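{- For every integer $k\ge4$, the thin headless spider $H_k$ satisfies $\gamma^{\mathrm{FD}}(H_k)=2k-2$ and $\gamma^{\mathrm{FTD}}(H_k)=2k-1$.
   Context: The thin headless spider $H_k$ is the graph on vertex set $Q\cup S$ with $Q=\{q_1,\dots,q_k\}$ a clique, $S=\{s_1,\dots,s_k\}$ a stable set, and $s_i$ adjacent to $q_j$ if and only if $i=j$. For a vertex $v$, $N(v)$ is its open and $N[v]=N(v)\cup\{v\}$ its closed neighborhood. A vertex set $C$ is full-separating if for all distinct $u,v$, $(N(v)\cap C)\setminus\{u\}\neq(N(u)\cap C)\setminus\{v\}$; dominating if $N[v]\cap C\neq\emptyset$ for all $v$; total-dominating if $N(v)\cap C\neq\emptyset$ for all $v$. An FD-code is a full-separating dominating set and an FTD-code a full-separating total-dominating set; $\gamma^{\mathrm{FD}}$, $\gamma^{\mathrm{FTD}}$ denote their minimum cardinalities. -}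

module Defs where

open import Data.Nat using (ℕ; _+_; _≤_)
open import Data.Fin using (Fin; splitAt)
open import Data.Fin.Subset using (Subset; _∈_; ∣_∣)
open import Data.Sum using (_⊎_; inj₁; inj₂)
open import Data.Product using (Σ; _×_; ∃)
open import Data.Empty using (⊥)
open import Data.Unit using (⊤)
open import Relation.Binary.PropositionalEquality using (_≡_; _≢_)
open import Relation.Nullary using (¬_)

record Graph (n : ℕ) : Set₁ where
  field
    Adj : Fin n → Fin n → Set

open Graph public

-- Vertex code: position i < k (via splitAt k) is q_i, position k + i is s_i.
-- H_k adjacency on Q ⊎ S.
HAdj : {k : ℕ} → Fin k ⊎ Fin k → Fin k ⊎ Fin k → Set
HAdj (inj₁ i) (inj₁ j) = i ≢ j
HAdj (inj₁ i) (inj₂ j) = i ≡ j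
HAdj (inj₂ i) (inj₁ j) = i ≡ j
HAdj (inj₂ i) (inj₂ j) = ⊥

H : (k : ℕ) → Graph (k + k)
H k = record { Adj = λ u v → HAdj (splitAt k u) (splitAt k v) }


module _ {n : ℕ} (G : Graph n) where

  -- C is full-separating: for all distinct u, v there is a vertex w that lies in
  -- exactly one of (N(v) ∩ C) ∖ {u} and (N(u) ∩ C) ∖ {v}, i.e. the two sets differ.
  InSepSet : Subset n → Fin n → Fin n → Fin n → Set
  InSepSet C v u w = Adj G v w × w ∈ C × w ≢ u

  FullSeparating : Subset n → Set
  FullSeparating C = ∀ u v → u ≢ v →
    ¬ (∀ w → (InSepSet C v u w → InSepSet C u v w) × (InSepSet C u v w → InSepSet C v u w))

  Dominating : Subset n → Set
  Dominating C = ∀ v → ∃ λ w → (w ≡ v ⊎ Adj G v w) × w ∈ C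

  TotalDominating : Subset n → Set
  TotalDominating C = ∀ v → ∃ λ w → Adj G v w × w ∈ C

  FDCode : Subset n → Set
  FDCode C = FullSeparating C × Dominating C

  FTDCode : Subset n → Set
  FTDCode C = FullSeparating C × TotalDominating C

  MinCard : (Subset n → Set) → ℕ → Set
  MinCard P m = (Σ (Subset n) λ C → P C × ∣ C ∣ ≡ m) × (∀ C → P C → m ≤ ∣ C ∣)


  γFD≡ : ℕ → Set
  γFD≡ = MinCard FDCode

  γFTD≡ : ℕ → Set
  γFTD≡ = MinCard FTDCode

-- Full separation forces a code C to miss at most one clique vertex: if q_i, q_j ∉ C, the
-- leaves s_i and s_j have no separating vertex at all. Symmetrically it misses at most one leaf:
-- if s_i, s_j ∉ C, then q_i and q_j are twins inside the clique. Total domination of the leaf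
-- s_i forces q_i ∈ C. Conversely Q ∖ {q_a} ∪ S ∖ {s_b} with a ≠ b is an FD-code and
-- Q ∪ S ∖ {s_b} an FTD-code; a clique vertex q_i and a leaf s_j are separated by a third clique
-- vertex q_m with m ∉ {i, j, a}, which is where k ≥ 4 is needed.
module Submission where

open import Defs

open import Data.Nat using (ℕ; zero; suc; s≤s; _+_; _∸_; _*_; _≤_; _<_)
open import Data.Nat.Properties using (≤-trans; <⇒≱; +-mono-≤; m∸n≤m; +-suc; +-identityʳ)
open import Data.Fin using (Fin; zero; suc; _↑ˡ_; _↑ʳ_; join; splitAt)
open import Data.Fin.Properties using (splitAt-join; join-splitAt; _≟_; any?; all?; ¬∀⟶∃¬; injective⇒≤)
open import Data.Fin.Subset using (Subset; _∈_; _∉_; _⊆_; ∣_∣; ⊤; ∁; ⁅_⁆; inside; outside)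
open import Data.Fin.Subset.Properties
  using (_∈?_; ∈⊤; ∣⊤∣≡n; ∣∁p∣≡n∸∣p∣; ∣⁅x⁆∣≡1; p⊆q⇒∣p∣≤∣q∣; x∉p⇒x∈∁p; x∈∁p⇒x∉p; x≢y⇒x∉⁅y⁆; x∈⁅x⁆)
open import Data.Vec using ([]; _∷_; _++_; lookup)
import Data.Vec as Vec
open import Data.Vec.Properties using (lookup-++ˡ; lookup-++ʳ; []=⇒lookup; lookup⇒[]=)
open import Data.Product using (∃; _×_; _,_; proj₁; proj₂; swap)
open import Data.Sum using (_⊎_; inj₁; inj₂)
import Data.Sum as Sum
open import Data.Sum.Properties using (inj₁-injective; inj₂-injective)
open import Data.Empty using (⊥-elim)
open import Function using (id; _∘_)
open import Relation.Binary.PropositionalEquality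
open import Relation.Nullary using (¬_; yes; no; ¬?; contradiction)
open import Relation.Nullary.Decidable using (decidable-stable)

<⇒∃∉image : ∀ {r k} → r < k → (f : Fin r → Fin k) → ∃ λ m → ∀ i → m ≢ f i
<⇒∃∉image {r} {k} r<k f with any? (λ m → all? (λ i → ¬? (m ≟ f i)))
... | yes avoided = avoided
... | no covered = contradiction (injective⇒≤ preimage-injective) (<⇒≱ r<k)
  where
  hit : ∀ m → ∃ λ i → ¬ m ≢ f i
  hit m = ¬∀⟶∃¬ r _ (λ i → ¬? (m ≟ f i)) (λ m∉ → covered (m , m∉))

  preimage : Fin k → Fin r
  preimage m = proj₁ (hit m)

  f∘preimage : ∀ m → m ≡ f (preimage m)
  f∘preimage m = decidable-stable (m ≟ f (preimage m)) (proj₂ (hit m))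

  preimage-injective : ∀ {m m′} → preimage m ≡ preimage m′ → m ≡ m′
  preimage-injective {m} {m′} eq = trans (f∘preimage m) (trans (cong f eq) (sym (f∘preimage m′)))

module _ {m n : ℕ} (p : Subset m) (q : Subset n) where

  ∈-++⁺ˡ : ∀ {i} → i ∈ p → i ↑ˡ n ∈ p ++ q
  ∈-++⁺ˡ {i} i∈p = lookup⇒[]= _ (p ++ q) (trans (lookup-++ˡ p q i) ([]=⇒lookup i∈p))

  ∈-++⁻ˡ : ∀ {i} → i ↑ˡ n ∈ p ++ q → i ∈ p
  ∈-++⁻ˡ {i} i∈p++q = lookup⇒[]= i p (trans (sym (lookup-++ˡ p q i)) ([]=⇒lookup i∈p++q))

  ∈-++⁺ʳ : ∀ {i} → i ∈ q → m ↑ʳ i ∈ p ++ q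
  ∈-++⁺ʳ {i} i∈q = lookup⇒[]= _ (p ++ q) (trans (lookup-++ʳ p q i) ([]=⇒lookup i∈q))

  ∈-++⁻ʳ : ∀ {i} → m ↑ʳ i ∈ p ++ q → i ∈ q
  ∈-++⁻ʳ {i} i∈p++q = lookup⇒[]= i q (trans (sym (lookup-++ʳ p q i)) ([]=⇒lookup i∈p++q))

∣p++q∣≡∣p∣+∣q∣ : ∀ {m n} (p : Subset m) (q : Subset n) → ∣ p ++ q ∣ ≡ ∣ p ∣ + ∣ q ∣
∣p++q∣≡∣p∣+∣q∣ []            q = refl
∣p++q∣≡∣p∣+∣q∣ (inside ∷ p)  q = cong suc (∣p++q∣≡∣p∣+∣q∣ p q)
∣p++q∣≡∣p∣+∣q∣ (outside ∷ p) q = ∣p++q∣≡∣p∣+∣q∣ p q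

∣∁⁅x⁆∣≡n∸1 : ∀ {n} (x : Fin n) → ∣ ∁ ⁅ x ⁆ ∣ ≡ n ∸ 1
∣∁⁅x⁆∣≡n∸1 {n} x = trans (∣∁p∣≡n∸∣p∣ ⁅ x ⁆) (cong (n ∸_) (∣⁅x⁆∣≡1 x))

y≢x⇒y∈∁⁅x⁆ : ∀ {n} {x y : Fin n} → y ≢ x → y ∈ ∁ ⁅ x ⁆
y≢x⇒y∈∁⁅x⁆ y≢x = x∉p⇒x∈∁p (x≢y⇒x∉⁅y⁆ y≢x)

full⇒n≤∣p∣ : ∀ {n} {p : Subset n} → (∀ x → x ∈ p) → n ≤ ∣ p ∣
full⇒n≤∣p∣ {n} {p} all∈p = subst (_≤ ∣ p ∣) (∣⊤∣≡n n) (p⊆q⇒∣p∣≤∣q∣ {p = ⊤} (λ {x} _ → all∈p x))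

meetsEveryPair⇒n∸1≤∣p∣ : ∀ {n} {p : Subset n} → (∀ x y → x ≢ y → x ∈ p ⊎ y ∈ p) → n ∸ 1 ≤ ∣ p ∣
meetsEveryPair⇒n∸1≤∣p∣ {n} {p} meets with all? (_∈? p)
... | yes all∈p = ≤-trans (m∸n≤m n 1) (full⇒n≤∣p∣ all∈p)
... | no ¬all∈p with x , x∉p ← ¬∀⟶∃¬ n _ (_∈? p) ¬all∈p =
  subst (_≤ ∣ p ∣) (∣∁⁅x⁆∣≡n∸1 x) (p⊆q⇒∣p∣≤∣q∣ ∁⁅x⁆⊆p)
  where
  ∁⁅x⁆⊆p : ∁ ⁅ x ⁆ ⊆ p
  ∁⁅x⁆⊆p {y} y∈∁⁅x⁆ with meets y x (λ { refl → x∈∁p⇒x∉p y∈∁⁅x⁆ (x∈⁅x⁆ x) })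
  ... | inj₁ y∈p = y∈p
  ... | inj₂ x∈p = contradiction x∈p x∉p

double∸2 : ∀ k → 2 * k ∸ 2 ≡ (k ∸ 1) + (k ∸ 1)
double∸2 zero = refl
double∸2 (suc m) rewrite +-identityʳ m | +-suc m m = refl

double∸1 : ∀ k → 2 * k ∸ 1 ≡ k + (k ∸ 1)
double∸1 zero = refl
double∸1 (suc m) rewrite +-identityʳ m | +-suc m m = refl

module _ {n : ℕ} (G : Graph n) (C : Subset n) where

  Unseparated : Fin n → Fin n → Set
  Unseparated u v = ∀ w → (InSepSet G C v u w → InSepSet G C u v w) × (InSepSet G C u v w → InSepSet G C v u w)

  Unseparated-sym : ∀ {u v} → Unseparated u v → Unseparated v u
  Unseparated-sym unsep w = swap (unsep w)

  separatedBy : ∀ {u v} w → InSepSet G C u v w → ¬ InSepSet G C v u w → ¬ Unseparated u v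
  separatedBy w inU ¬inV unsep = ¬inV (proj₂ (unsep w) inU)

module Spider (k : ℕ) (3<k : 3 < k) where

  vertex : Fin k ⊎ Fin k → Fin (k + k)
  vertex = join k k

  q s : Fin k → Fin (k + k)
  q i = vertex (inj₁ i)
  s i = vertex (inj₂ i)

  vertex-injective : ∀ {x y} → vertex x ≡ vertex y → x ≡ y
  vertex-injective {x} {y} eq =
    trans (sym (splitAt-join k k x)) (trans (cong (splitAt k) eq) (splitAt-join k k y))

  ∀-vertex : {P : Fin (k + k) → Set} → (∀ x → P (vertex x)) → ∀ w → P w
  ∀-vertex {P} P-vertex w = subst P (join-splitAt k k w) (P-vertex (splitAt k w))

  Adj≡HAdj : ∀ x y → Adj (H k) (vertex x) (vertex y) ≡ HAdj x y
  Adj≡HAdj x y = cong₂ HAdj (splitAt-join k k x) (splitAt-join k k y)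

  toHAdj : ∀ {x y} → Adj (H k) (vertex x) (vertex y) → HAdj x y
  toHAdj {x} {y} = subst id (Adj≡HAdj x y)

  fromHAdj : ∀ {x y} → HAdj x y → Adj (H k) (vertex x) (vertex y)
  fromHAdj {x} {y} = subst id (sym (Adj≡HAdj x y))

  fresh : (i j a : Fin k) → ∃ λ m → m ≢ i × m ≢ j × m ≢ a
  fresh i j a with m , m∉ ← <⇒∃∉image 3<k (lookup (i ∷ j ∷ a ∷ [])) =
    m , m∉ zero , m∉ (suc zero) , m∉ (suc (suc zero))

  other : (i : Fin k) → ∃ λ m → m ≢ i
  other i with m , m≢i , _ ← fresh i i i = m , m≢i

  module _ (C : Subset (k + k)) where

    separatedBy-vertex : ∀ x y z → HAdj x z → vertex z ∈ C → z ≢ y → ¬ HAdj y z →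
                         ¬ Unseparated (H k) C (vertex x) (vertex y)
    separatedBy-vertex _ _ z x~z z∈C z≢y y≁z =
      separatedBy (H k) C (vertex z) (fromHAdj x~z , z∈C , z≢y ∘ vertex-injective)
                  (λ (y~z , _) → y≁z (toHAdj y~z))

    ContainsAllBut : Fin k → Fin k → Set
    ContainsAllBut a b = (∀ i → i ≢ a → q i ∈ C) × (∀ i → i ≢ b → s i ∈ C)

    module _ {a b : Fin k} (allBut : ContainsAllBut a b) where

      private
        q∈C : ∀ i → i ≢ a → q i ∈ C
        q∈C = proj₁ allBut

        s∈C : ∀ i → i ≢ b → s i ∈ C
        s∈C = proj₂ allBut

      q-separated : ∀ {i j} → i ≢ j → ¬ Unseparated (H k) C (q i) (q j)
      q-separated {i} {j} i≢j with i ≟ b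
      ... | no i≢b = separatedBy-vertex (inj₁ i) (inj₁ j) (inj₂ i) refl (s∈C i i≢b) (λ ()) (i≢j ∘ sym)
      ... | yes refl = separatedBy-vertex (inj₁ j) (inj₁ i) (inj₂ j) refl (s∈C j (i≢j ∘ sym)) (λ ()) i≢j
                       ∘ Unseparated-sym (H k) C

      s-separated : ∀ {i j} → i ≢ j → ¬ Unseparated (H k) C (s i) (s j)
      s-separated {i} {j} i≢j with i ≟ a
      ... | no i≢a = separatedBy-vertex (inj₂ i) (inj₂ j) (inj₁ i) refl (q∈C i i≢a) (λ ()) (i≢j ∘ sym)
      ... | yes refl = separatedBy-vertex (inj₂ j) (inj₂ i) (inj₁ j) refl (q∈C j (i≢j ∘ sym)) (λ ()) i≢j
                       ∘ Unseparated-sym (H k) C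

      qs-separated : ∀ i j → ¬ Unseparated (H k) C (q i) (s j)
      qs-separated i j with m , m≢i , m≢j , m≢a ← fresh i j a =
        separatedBy-vertex (inj₁ i) (inj₂ j) (inj₁ m) (m≢i ∘ sym) (q∈C m m≢a) (λ ()) (m≢j ∘ sym)

      containsAllBut⇒fullSeparating : FullSeparating (H k) C
      containsAllBut⇒fullSeparating =
        ∀-vertex λ x → ∀-vertex λ y vx≢vy → separated x y (vx≢vy ∘ cong vertex)
        where
        separated : ∀ x y → x ≢ y → ¬ Unseparated (H k) C (vertex x) (vertex y)
        separated (inj₁ i) (inj₁ j) x≢y = q-separated (x≢y ∘ cong inj₁)
        separated (inj₂ i) (inj₂ j) x≢y = s-separated (x≢y ∘ cong inj₂)
        separated (inj₁ i) (inj₂ j) _   = qs-separated i j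
        separated (inj₂ j) (inj₁ i) _   = qs-separated i j ∘ Unseparated-sym (H k) C

      containsAllBut⇒dominating : a ≢ b → Dominating (H k) C
      containsAllBut⇒dominating a≢b = ∀-vertex dominated
        where
        s∈C-at-a : ∀ {i} → i ≡ a → s i ∈ C
        s∈C-at-a {i} refl = s∈C i a≢b

        dominated : ∀ x → ∃ λ w → (w ≡ vertex x ⊎ Adj (H k) (vertex x) w) × w ∈ C
        dominated (inj₁ i) with i ≟ a
        ... | no i≢a  = q i , inj₁ refl , q∈C i i≢a
        ... | yes i≡a = s i , inj₂ (fromHAdj {inj₁ i} {inj₂ i} refl) , s∈C-at-a i≡a
        dominated (inj₂ i) with i ≟ a
        ... | no i≢a  = q i , inj₂ (fromHAdj {inj₂ i} {inj₁ i} refl) , q∈C i i≢a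
        ... | yes i≡a = s i , inj₁ refl , s∈C-at-a i≡a

    containsQ⇒totalDominating : (∀ i → q i ∈ C) → TotalDominating (H k) C
    containsQ⇒totalDominating q∈C = ∀-vertex dominated
      where
      dominated : ∀ x → ∃ λ w → Adj (H k) (vertex x) w × w ∈ C
      dominated (inj₁ i) with m , m≢i ← other i = q m , fromHAdj {inj₁ i} {inj₁ m} (m≢i ∘ sym) , q∈C m
      dominated (inj₂ i) = q i , fromHAdj {inj₂ i} {inj₁ i} refl , q∈C i

    s-neighbour : ∀ {i} w → Adj (H k) (s i) w → w ≡ q i
    s-neighbour {i} = ∀-vertex neighbour
      where
      neighbour : ∀ x → Adj (H k) (s i) (vertex x) → vertex x ≡ q i
      neighbour (inj₁ m) si~qm = cong q (sym (toHAdj {inj₂ i} {inj₁ m} si~qm))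
      neighbour (inj₂ m) si~sm = ⊥-elim (toHAdj {inj₂ i} {inj₂ m} si~sm)

    totalDominating⇒q∈C : TotalDominating (H k) C → ∀ i → q i ∈ C
    totalDominating⇒q∈C td i with w , si~w , w∈C ← td (s i) = subst (_∈ C) (s-neighbour w si~w) w∈C

    q∉C⇒noSeparator : ∀ {i u} → q i ∉ C → ∀ w → ¬ InSepSet (H k) C (s i) u w
    q∉C⇒noSeparator qi∉C w (si~w , w∈C , _) = qi∉C (subst (_∈ C) (s-neighbour w si~w) w∈C)

    s∉C⇒separator-swap : ∀ {i j} → s i ∉ C → ∀ w →
                         InSepSet (H k) C (q i) (q j) w → InSepSet (H k) C (q j) (q i) w
    s∉C⇒separator-swap {i} {j} si∉C = ∀-vertex separator
      where
      separator : ∀ x → InSepSet (H k) C (q i) (q j) (vertex x) → InSepSet (H k) C (q j) (q i) (vertex x)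
      separator (inj₁ m) (qi~qm , qm∈C , qm≢qj) =
        fromHAdj {inj₁ j} {inj₁ m} (qm≢qj ∘ cong q ∘ sym) , qm∈C ,
        toHAdj {inj₁ i} {inj₁ m} qi~qm ∘ sym ∘ inj₁-injective ∘ vertex-injective
      separator (inj₂ m) (qi~sm , sm∈C , _) =
        ⊥-elim (si∉C (subst (λ l → s l ∈ C) (sym (toHAdj {inj₁ i} {inj₂ m} qi~sm)) sm∈C))

    fullSeparating⇒q-pair : FullSeparating (H k) C → ∀ i j → i ≢ j → q i ∈ C ⊎ q j ∈ C
    fullSeparating⇒q-pair sep i j i≢j with q i ∈? C | q j ∈? C
    ... | yes qi∈C | _        = inj₁ qi∈C
    ... | no _     | yes qj∈C = inj₂ qj∈C
    ... | no qi∉C  | no qj∉C  = ⊥-elim (sep (s i) (s j) (i≢j ∘ inj₂-injective ∘ vertex-injective) twins)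
      where
      twins : Unseparated (H k) C (s i) (s j)
      twins w = ⊥-elim ∘ q∉C⇒noSeparator qj∉C w , ⊥-elim ∘ q∉C⇒noSeparator qi∉C w

    fullSeparating⇒s-pair : FullSeparating (H k) C → ∀ i j → i ≢ j → s i ∈ C ⊎ s j ∈ C
    fullSeparating⇒s-pair sep i j i≢j with s i ∈? C | s j ∈? C
    ... | yes si∈C | _        = inj₁ si∈C
    ... | no _     | yes sj∈C = inj₂ sj∈C
    ... | no si∉C  | no sj∉C  = ⊥-elim (sep (q i) (q j) (i≢j ∘ inj₁-injective ∘ vertex-injective) twins)
      where
      twins : Unseparated (H k) C (q i) (q j)
      twins w = s∉C⇒separator-swap sj∉C w , s∉C⇒separator-swap si∉C w

  fd-lowerBound : ∀ C → FDCode (H k) C → 2 * k ∸ 2 ≤ ∣ C ∣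
  fd-lowerBound C (sep , _) with A , B , refl ← Vec.splitAt k C =
    subst₂ _≤_ (sym (double∸2 k)) (sym (∣p++q∣≡∣p∣+∣q∣ A B))
      (+-mono-≤ (meetsEveryPair⇒n∸1≤∣p∣ λ i j i≢j →
                   Sum.map (∈-++⁻ˡ A B) (∈-++⁻ˡ A B) (fullSeparating⇒q-pair (A ++ B) sep i j i≢j))
                (meetsEveryPair⇒n∸1≤∣p∣ λ i j i≢j →
                   Sum.map (∈-++⁻ʳ A B) (∈-++⁻ʳ A B) (fullSeparating⇒s-pair (A ++ B) sep i j i≢j)))

  ftd-lowerBound : ∀ C → FTDCode (H k) C → 2 * k ∸ 1 ≤ ∣ C ∣
  ftd-lowerBound C (sep , td) with A , B , refl ← Vec.splitAt k C =
    subst₂ _≤_ (sym (double∸1 k)) (sym (∣p++q∣≡∣p∣+∣q∣ A B))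
      (+-mono-≤ (full⇒n≤∣p∣ λ i → ∈-++⁻ˡ A B (totalDominating⇒q∈C (A ++ B) td i))
                (meetsEveryPair⇒n∸1≤∣p∣ λ i j i≢j →
                   Sum.map (∈-++⁻ʳ A B) (∈-++⁻ʳ A B) (fullSeparating⇒s-pair (A ++ B) sep i j i≢j)))

  smallFDCode : ∀ a b → a ≢ b → ∃ λ C → FDCode (H k) C × ∣ C ∣ ≡ 2 * k ∸ 2
  smallFDCode a b a≢b =
    C , (containsAllBut⇒fullSeparating C allBut , containsAllBut⇒dominating C allBut a≢b) ,
    trans (∣p++q∣≡∣p∣+∣q∣ (∁ ⁅ a ⁆) (∁ ⁅ b ⁆))
          (trans (cong₂ _+_ (∣∁⁅x⁆∣≡n∸1 a) (∣∁⁅x⁆∣≡n∸1 b)) (sym (double∸2 k)))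
    where
    C : Subset (k + k)
    C = ∁ ⁅ a ⁆ ++ ∁ ⁅ b ⁆
    allBut : ContainsAllBut C a b
    allBut = (λ i i≢a → ∈-++⁺ˡ (∁ ⁅ a ⁆) (∁ ⁅ b ⁆) (y≢x⇒y∈∁⁅x⁆ i≢a)) ,
             (λ i i≢b → ∈-++⁺ʳ (∁ ⁅ a ⁆) (∁ ⁅ b ⁆) (y≢x⇒y∈∁⁅x⁆ i≢b))

  smallFTDCode : Fin k → ∃ λ C → FTDCode (H k) C × ∣ C ∣ ≡ 2 * k ∸ 1
  smallFTDCode b =
    C , (containsAllBut⇒fullSeparating C allBut , containsQ⇒totalDominating C q∈C) ,
    trans (∣p++q∣≡∣p∣+∣q∣ (⊤ {k}) (∁ ⁅ b ⁆))
          (trans (cong₂ _+_ (∣⊤∣≡n k) (∣∁⁅x⁆∣≡n∸1 b)) (sym (double∸1 k)))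
    where
    C : Subset (k + k)
    C = ⊤ {k} ++ ∁ ⁅ b ⁆
    q∈C : ∀ i → q i ∈ C
    q∈C i = ∈-++⁺ˡ ⊤ (∁ ⁅ b ⁆) ∈⊤
    allBut : ContainsAllBut C b b
    allBut = (λ i _ → q∈C i) , (λ i i≢b → ∈-++⁺ʳ ⊤ (∁ ⁅ b ⁆) (y≢x⇒y∈∁⁅x⁆ i≢b))

theorem8 : (k : ℕ) → 4 ≤ k → γFD≡ (H k) (2 * k ∸ 2) × γFTD≡ (H k) (2 * k ∸ 1)
theorem8 1 (s≤s ())
theorem8 k@(suc (suc _)) 4≤k =
  (smallFDCode zero (suc zero) (λ ()) , fd-lowerBound) , (smallFTDCode zero , ftd-lowerBound)
  where open Spider k 4≤k
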